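{- Let $G$ be a finite abelian group, $R,L\subseteq G$ with $R=R^{ -1}$, $L=L^{ -1}$, $1\notin R\cup L$, and let $\Gamma=\mathrm{SC}(G;R,L,\{1\})$ be connected, with $A=\mathrm{Aut}(\Gamma)$. Suppose $Y\neq\emptyset$. Then $\Gamma$ is normal if and only if $A_{(1,1)}=X$.
   Context: $\mathrm{SC}(G;R,L,\{1\})$ is the graph with vertex set $G\times\{1,2\}$ and edges $\{(x,1),(y,1)\}$ for $yx^{ -1}\in R$, $\{(x,2),(y,2)\}$ for $yx^{ -1}\in L$, and $\{(x,1),(x,2)\}$ for $x\in G$. $R_G=\{\rho_g\mid g\in G\}$ where $(x,i)^{\rho_g}=(xg,i)$; $\Gamma$ is normal if $R_G\trianglelefteq \mathrm{Aut}(\Gamma)$. $A_{(1,1)}$ is the stabilizer of the vertex $(1,1)$ in $A$. For $\sigma\in\mathrm{Aut}(G)$ define $\varphi_\sigma:(x,i)\mapsto(x^\sigma,i)$ for $i=1,2$, and $\psi_\sigma:(x,1)\mapsto(x^\sigma,2),\ (x,2)\mapsto(x^\sigma,1)$. Let $X=\{\varphi_\sigma\mid\sigma\in\mathrm{Aut}(G),R^\sigma=R,L^\sigma=L\}$ and $Y=\{\psi_\sigma\mid\sigma\in\mathrm{Aut}(G),R^\sigma=L,L^\sigma=R\}$. -}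

module Defs where

open import Level using (0ℓ)
open import Data.Nat using (ℕ)
open import Data.Fin using (Fin)
open import Data.Product using (Σ; ∃; _×_; _,_; proj₁)
open import Data.Sum using (_⊎_)
open import Relation.Nullary using (¬_)
open import Relation.Unary using (Pred)
open import Relation.Binary.PropositionalEquality using (_≡_)
open import Relation.Binary.Construct.Closure.ReflexiveTransitive using (Star)
open import Algebra.Core using (Op₁; Op₂)
open import Algebra.Structures using (IsAbelianGroup)
open import Function.Bundles using (_↔_; _⇔_)

record FiniteAbelianGroup : Set₁ where
  field
    Carrier        : Set
    _∙_            : Op₂ Carrier
    ε              : Carrier
    _⁻¹            : Op₁ Carrier
    isAbelianGroup : IsAbelianGroup _≡_ _∙_ ε _⁻¹
    size           : ℕ
    enumeration    : Carrier ↔ Fin size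
  infixl 7 _∙_
  infix 8 _⁻¹

module _ (G : FiniteAbelianGroup) where
  open FiniteAbelianGroup G

  Subset : Set₁
  Subset = Pred Carrier 0ℓ

  _≐_ : Subset → Subset → Set
  S ≐ T = ∀ x → (S x → T x) × (T x → S x)

  inv-set : Subset → Subset
  inv-set S y = ∃ λ x → S x × (x ⁻¹ ≡ y)

  image : (Carrier → Carrier) → Subset → Subset
  image σ S y = ∃ λ x → S x × (σ x ≡ y)

  record IsGroupAut (σ : Carrier → Carrier) : Set where
    field
      hom     : ∀ x y → σ (x ∙ y) ≡ σ x ∙ σ y
      inverse : Carrier → Carrier
      invˡ    : ∀ x → inverse (σ x) ≡ x
      invʳ    : ∀ x → σ (inverse x) ≡ x

  data Layer : Set where
    one two : Layer

  V : Set
  V = Carrier × Layer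

  data Adj (R L : Subset) : V → V → Set where
    edge₁  : ∀ {x y} → R (y ∙ x ⁻¹) → Adj R L (x , one) (y , one)
    edge₂  : ∀ {x y} → L (y ∙ x ⁻¹) → Adj R L (x , two) (y , two)
    edge₁₂ : ∀ {x} → Adj R L (x , one) (x , two)
    edge₂₁ : ∀ {x} → Adj R L (x , two) (x , one)

  Connected : (R L : Subset) → Set
  Connected R L = ∀ u v → Star (Adj R L) u v

  record GraphAut (R L : Subset) : Set where
    field
      to    : V → V
      from  : V → V
      invˡ  : ∀ v → from (to v) ≡ v
      invʳ  : ∀ v → to (from v) ≡ v
      adj   : ∀ u v → Adj R L u v ⇔ Adj R L (to u) (to v)

  ρ : Carrier → V → V
  ρ g (x , i) = (x ∙ g , i)

  InRG : (V → V) → Set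
  InRG f = ∃ λ g → ∀ v → f v ≡ ρ g v

  -- Γ is normal: R_G ⊴ Aut(Γ), i.e. α⁻¹ R_G α ⊆ R_G for every α ∈ Aut(Γ)
  IsNormal : (R L : Subset) → Set
  IsNormal R L = ∀ (α : GraphAut R L) (g : Carrier) →
    InRG (λ v → GraphAut.to α (ρ g (GraphAut.from α v)))

  φ : (Carrier → Carrier) → V → V
  φ σ (x , i) = (σ x , i)

  swap : Layer → Layer
  swap one = two
  swap two = one

  ψ : (Carrier → Carrier) → V → V
  ψ σ (x , i) = (σ x , swap i)

  InX : (R L : Subset) → (V → V) → Set
  InX R L f = ∃ λ σ → IsGroupAut σ × (image σ R ≐ R) × (image σ L ≐ L)
                    × (∀ v → f v ≡ φ σ v)

  InY : (R L : Subset) → (V → V) → Set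
  InY R L f = ∃ λ σ → IsGroupAut σ × (image σ R ≐ L) × (image σ L ≐ R)
                    × (∀ v → f v ≡ ψ σ v)

  v₁₁ : V
  v₁₁ = (ε , one)

  -- A_{(1,1)} = X, as sets of maps V → V (up to pointwise equality)
  StabEqX : (R L : Subset) → Set
  StabEqX R L =
    (∀ (α : GraphAut R L) → GraphAut.to α v₁₁ ≡ v₁₁ → InX R L (GraphAut.to α))
    × (∀ (f : V → V) → InX R L f →
         Σ (GraphAut R L) λ α → (∀ v → GraphAut.to α v ≡ f v) × (f v₁₁ ≡ v₁₁))

-- If R_G ⊴ A, an automorphism α fixing (1,1) satisfies α ρ_g = ρ_{h(g)} α for some map h;
-- since α commutes with translations and fixes the edge {(1,1),(1,2)}, it preserves both
-- layers, so α = φ_h, where h is an automorphism of G fixing R and L because α preserves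
-- edges. Conversely, if A_{(1,1)} = X, then composing any α with ρ_{c⁻¹} and, when α(1,1)
-- lies in layer 2, with an element ψ_τ of Y lands in the stabiliser; hence α has the form
-- (x, i) ↦ (θ(x) c, π(i)) with θ a homomorphism, and such a map satisfies α ρ_g = ρ_{θ(g)} α
-- because G is abelian.
module Submission where

open import Defs
open import Level using (0ℓ)
open import Data.Product using (∃; _×_; _,_; proj₁; proj₂; Σ)
open import Data.Sum using (_⊎_)
open import Function using (_∘_; id)
open import Function.Bundles using (_⇔_; mk⇔; Equivalence)
open import Function.Definitions using (Injective)
import Function.Properties.Equivalence as ⇔
open import Relation.Nullary using (¬_; contradiction)
open import Relation.Binary.PropositionalEquality
  using (_≡_; refl; sym; trans; cong; cong₂; subst; subst₂; module ≡-Reasoning)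
open import Algebra.Bundles using (AbelianGroup)
open import Algebra.Morphism.Consequences using (homomorphic₂-inv)
import Algebra.Properties.Group as GroupProperties
import Algebra.Properties.Loop as LoopProperties
import Algebra.Properties.CommutativeSemigroup as CommutativeSemigroupProperties
import Relation.Binary.Reasoning.Setoid as SetoidReasoning

module _ (G : FiniteAbelianGroup) where
  open FiniteAbelianGroup G

  private
    abelianGroup : AbelianGroup 0ℓ 0ℓ
    abelianGroup = record { isAbelianGroup = isAbelianGroup }

  open AbelianGroup abelianGroup
    using (group; magma; commutativeSemigroup; assoc; identityˡ; inverseʳ)
  open GroupProperties group
    using ( ∙-cancelʳ; //-rightDividesˡ; //-rightDividesʳ; identityʳ-unique; inverseʳ-unique
          ; ⁻¹-anti-homo-∙; loop)
  open LoopProperties loop using (x//ε≈x)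
  open CommutativeSemigroupProperties commutativeSemigroup using (xy∙z≈xz∙y)

  IsHom : (Carrier → Carrier) → Set
  IsHom σ = ∀ x y → σ (x ∙ y) ≡ σ x ∙ σ y

  ∘-isHom : ∀ {σ τ} → IsHom σ → IsHom τ → IsHom (σ ∘ τ)
  ∘-isHom {σ} {τ} σ-hom τ-hom x y = trans (cong σ (τ-hom x y)) (σ-hom (τ x) (τ y))

  hom-ε : ∀ {σ} → IsHom σ → σ ε ≡ ε
  hom-ε {σ} σ-hom = identityʳ-unique (σ ε) (σ ε) (trans (sym (σ-hom ε ε)) (cong σ (identityˡ ε)))

  hom-⁻¹ : ∀ {σ} → IsHom σ → ∀ x → σ (x ⁻¹) ≡ σ x ⁻¹
  hom-⁻¹ {σ} σ-hom x = inverseʳ-unique (σ x) (σ (x ⁻¹))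
    (trans (sym (σ-hom x (x ⁻¹))) (trans (cong σ (inverseʳ x)) (hom-ε σ-hom)))

  hom-quotient : ∀ {σ} → IsHom σ → ∀ x y → σ (y ∙ x ⁻¹) ≡ σ y ∙ σ x ⁻¹
  hom-quotient {σ} σ-hom x y = trans (σ-hom y (x ⁻¹)) (cong (σ y ∙_) (hom-⁻¹ σ-hom x))

  quotient-translateʳ : ∀ c x y → (y ∙ c) ∙ (x ∙ c) ⁻¹ ≡ y ∙ x ⁻¹
  quotient-translateʳ c x y = begin
    (y ∙ c) ∙ (x ∙ c) ⁻¹       ≡⟨ cong ((y ∙ c) ∙_) (⁻¹-anti-homo-∙ x c) ⟩
    (y ∙ c) ∙ (c ⁻¹ ∙ x ⁻¹)    ≡⟨ assoc y c (c ⁻¹ ∙ x ⁻¹) ⟩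
    y ∙ (c ∙ (c ⁻¹ ∙ x ⁻¹))    ≡⟨ cong (y ∙_) (sym (assoc c (c ⁻¹) (x ⁻¹))) ⟩
    y ∙ ((c ∙ c ⁻¹) ∙ x ⁻¹)    ≡⟨ cong (λ z → y ∙ (z ∙ x ⁻¹)) (inverseʳ c) ⟩
    y ∙ (ε ∙ x ⁻¹)             ≡⟨ cong (y ∙_) (identityˡ (x ⁻¹)) ⟩
    y ∙ x ⁻¹                   ∎
    where open ≡-Reasoning

  module _ {σ : Carrier → Carrier} (σ-aut : IsGroupAut G σ) where
    open IsGroupAut σ-aut

    aut-injective : Injective _≡_ _≡_ σ
    aut-injective {x} {y} σx≡σy = trans (sym (invˡ x)) (trans (cong inverse σx≡σy) (invˡ y))

    aut-surjective : ∀ y → ∃ λ x → σ x ≡ y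
    aut-surjective y = inverse y , invʳ y

    aut-inverse-isHom : IsHom inverse
    aut-inverse-isHom = homomorphic₂-inv magma magma (cong inverse)
      ((λ y≡τx → trans (cong σ y≡τx) (invʳ _)) , (λ y≡σx → trans (cong inverse y≡σx) (invˡ _)))
      hom

  image≐⇒∈⇔ : ∀ {σ} (P Q : Subset G) → Injective _≡_ _≡_ σ →
    _≐_ G (image G σ P) Q → ∀ z → P z ⇔ Q (σ z)
  image≐⇒∈⇔ P Q σ-injective σP≐Q z = mk⇔
    (λ Pz → proj₁ (σP≐Q _) (z , Pz , refl))
    (λ Qσz → let (x , Px , σx≡σz) = proj₂ (σP≐Q _) Qσz in subst P (σ-injective σx≡σz) Px)

  ∈⇔⇒image≐ : ∀ {σ} (P Q : Subset G) → (∀ y → ∃ λ x → σ x ≡ y) →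
    (∀ z → P z ⇔ Q (σ z)) → _≐_ G (image G σ P) Q
  ∈⇔⇒image≐ P Q σ-surjective P⇔Qσ y =
    (λ { (x , Px , refl) → Equivalence.to (P⇔Qσ x) Px })
    , (λ Qy → let (x , σx≡y) = σ-surjective y in
              x , Equivalence.from (P⇔Qσ x) (subst Q (sym σx≡y) Qy) , σx≡y)

  aut-quotient⇔ : ∀ {σ} → IsGroupAut G σ → (P Q : Subset G) → _≐_ G (image G σ P) Q →
    ∀ x y → P (y ∙ x ⁻¹) ⇔ Q (σ y ∙ σ x ⁻¹)
  aut-quotient⇔ σ-aut P Q σP≐Q x y =
    subst (λ z → P (y ∙ x ⁻¹) ⇔ Q z) (hom-quotient (IsGroupAut.hom σ-aut) x y)
      (image≐⇒∈⇔ P Q (aut-injective σ-aut) σP≐Q (y ∙ x ⁻¹))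

  aut-≡⇔ : ∀ {σ} → IsGroupAut G σ → ∀ x y → x ≡ y ⇔ σ x ≡ σ y
  aut-≡⇔ {σ} σ-aut x y = mk⇔ (cong σ) (aut-injective σ-aut)

  IsAffine : (V G → V G) → Set
  IsAffine f = Σ (Carrier → Carrier) λ θ → IsHom θ × Σ Carrier λ c → Σ (Layer G → Layer G) λ π →
    ∀ x i → f (x , i) ≡ (θ x ∙ c , π i)

  affine-commutes-ρ : ∀ {f} → IsAffine f → ∀ g → ∃ λ k → ∀ w → f (ρ G g w) ≡ ρ G k (f w)
  affine-commutes-ρ {f} (θ , θ-hom , c , π , f≗) g = θ g , λ (x , i) → begin
    f (x ∙ g , i)              ≡⟨ f≗ (x ∙ g) i ⟩
    (θ (x ∙ g) ∙ c , π i)      ≡⟨ cong (λ z → z ∙ c , π i) (θ-hom x g) ⟩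
    ((θ x ∙ θ g) ∙ c , π i)    ≡⟨ cong (_, π i) (xy∙z≈xz∙y (θ x) (θ g) c) ⟩
    ((θ x ∙ c) ∙ θ g , π i)    ≡⟨ cong (ρ G (θ g)) (sym (f≗ x i)) ⟩
    ρ G (θ g) (f (x , i))      ∎
    where open ≡-Reasoning

  module _ (R L : Subset G) where

    Conn : Layer G → Subset G
    Conn one = R
    Conn two = L

    Edge : V G → V G → Set
    Edge (x , one) (y , one) = R (y ∙ x ⁻¹)
    Edge (x , two) (y , two) = L (y ∙ x ⁻¹)
    Edge (x , one) (y , two) = x ≡ y
    Edge (x , two) (y , one) = x ≡ y

    Edge-within : ∀ i x y → Edge (x , i) (y , i) ≡ Conn i (y ∙ x ⁻¹)
    Edge-within one x y = refl
    Edge-within two x y = refl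

    Adj⇔Edge : ∀ u v → Adj G R L u v ⇔ Edge u v
    Adj⇔Edge u v = mk⇔ (to u v) (from u v)
      where
      to : ∀ u v → Adj G R L u v → Edge u v
      to _ _ (edge₁ r) = r
      to _ _ (edge₂ l) = l
      to _ _ edge₁₂    = refl
      to _ _ edge₂₁    = refl
      from : ∀ u v → Edge u v → Adj G R L u v
      from (x , one) (y , one) r    = edge₁ r
      from (x , two) (y , two) l    = edge₂ l
      from (x , one) (y , two) refl = edge₁₂
      from (x , two) (y , one) refl = edge₂₁

    Edge-automorphism : (f f⁻¹ : V G → V G) → (∀ v → f⁻¹ (f v) ≡ v) → (∀ v → f (f⁻¹ v) ≡ v) →
      (∀ u v → Edge u v ⇔ Edge (f u) (f v)) → GraphAut G R L
    Edge-automorphism f f⁻¹ f⁻¹∘f f∘f⁻¹ f-Edge = record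
      { to = f ; from = f⁻¹ ; invˡ = f⁻¹∘f ; invʳ = f∘f⁻¹
      ; adj = λ u v → ⇔.trans (Adj⇔Edge u v) (⇔.trans (f-Edge u v) (⇔.sym (Adj⇔Edge (f u) (f v))))
      }

    infixr 9 _∘ᵃ_
    _∘ᵃ_ : GraphAut G R L → GraphAut G R L → GraphAut G R L
    β ∘ᵃ α = record
      { to = B.to ∘ A.to ; from = A.from ∘ B.from
      ; invˡ = λ v → trans (cong A.from (B.invˡ (A.to v))) (A.invˡ v)
      ; invʳ = λ v → trans (cong B.to (A.invʳ (B.from v))) (B.invʳ v)
      ; adj = λ u v → ⇔.trans (A.adj u v) (B.adj (A.to u) (A.to v))
      }
      where
      module A = GraphAut α
      module B = GraphAut β

    ρ-automorphism : Carrier → GraphAut G R L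
    ρ-automorphism c = Edge-automorphism (ρ G c) (ρ G (c ⁻¹)) ρ⁻¹∘ρ ρ∘ρ⁻¹ ρ-Edge
      where
      ρ⁻¹∘ρ : ∀ v → ρ G (c ⁻¹) (ρ G c v) ≡ v
      ρ⁻¹∘ρ (x , i) = cong (_, i) (//-rightDividesʳ c x)
      ρ∘ρ⁻¹ : ∀ v → ρ G c (ρ G (c ⁻¹) v) ≡ v
      ρ∘ρ⁻¹ (x , i) = cong (_, i) (//-rightDividesˡ c x)
      translate⇔ : ∀ x y → x ≡ y ⇔ x ∙ c ≡ y ∙ c
      translate⇔ x y = mk⇔ (cong (_∙ c)) (∙-cancelʳ c x y)
      ρ-Edge : ∀ u v → Edge u v ⇔ Edge (ρ G c u) (ρ G c v)
      ρ-Edge (x , one) (y , one) rewrite quotient-translateʳ c x y = ⇔.refl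
      ρ-Edge (x , two) (y , two) rewrite quotient-translateʳ c x y = ⇔.refl
      ρ-Edge (x , one) (y , two) = translate⇔ x y
      ρ-Edge (x , two) (y , one) = translate⇔ x y

    module _ {σ : Carrier → Carrier} (σ-aut : IsGroupAut G σ) where
      open IsGroupAut σ-aut using (inverse; invˡ; invʳ)

      φ-automorphism : _≐_ G (image G σ R) R → _≐_ G (image G σ L) L → GraphAut G R L
      φ-automorphism σR≐R σL≐L = Edge-automorphism (φ G σ) (φ G inverse)
        (λ (x , i) → cong (_, i) (invˡ x)) (λ (x , i) → cong (_, i) (invʳ x)) φ-Edge
        where
        φ-Edge : ∀ u v → Edge u v ⇔ Edge (φ G σ u) (φ G σ v)
        φ-Edge (x , one) (y , one) = aut-quotient⇔ σ-aut R R σR≐R x y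
        φ-Edge (x , two) (y , two) = aut-quotient⇔ σ-aut L L σL≐L x y
        φ-Edge (x , one) (y , two) = aut-≡⇔ σ-aut x y
        φ-Edge (x , two) (y , one) = aut-≡⇔ σ-aut x y

      ψ-automorphism : _≐_ G (image G σ R) L → _≐_ G (image G σ L) R → GraphAut G R L
      ψ-automorphism σR≐L σL≐R = Edge-automorphism (ψ G σ) (ψ G inverse) ψ⁻¹∘ψ ψ∘ψ⁻¹ ψ-Edge
        where
        ψ⁻¹∘ψ : ∀ v → ψ G inverse (ψ G σ v) ≡ v
        ψ⁻¹∘ψ (x , one) = cong (_, one) (invˡ x)
        ψ⁻¹∘ψ (x , two) = cong (_, two) (invˡ x)
        ψ∘ψ⁻¹ : ∀ v → ψ G σ (ψ G inverse v) ≡ v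
        ψ∘ψ⁻¹ (x , one) = cong (_, one) (invʳ x)
        ψ∘ψ⁻¹ (x , two) = cong (_, two) (invʳ x)
        ψ-Edge : ∀ u v → Edge u v ⇔ Edge (ψ G σ u) (ψ G σ v)
        ψ-Edge (x , one) (y , one) = aut-quotient⇔ σ-aut R L σR≐L x y
        ψ-Edge (x , two) (y , two) = aut-quotient⇔ σ-aut L R σL≐R x y
        ψ-Edge (x , one) (y , two) = aut-≡⇔ σ-aut x y
        ψ-Edge (x , two) (y , one) = aut-≡⇔ σ-aut x y

    X⊆stabiliser : ∀ f → InX G R L f →
      Σ (GraphAut G R L) λ α → (∀ v → GraphAut.to α v ≡ f v) × (f (v₁₁ G) ≡ v₁₁ G)
    X⊆stabiliser f (σ , σ-aut , σR≐R , σL≐L , f≗φσ) =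
      φ-automorphism σ-aut σR≐R σL≐L , (λ v → sym (f≗φσ v)) ,
      trans (f≗φσ (v₁₁ G)) (cong (_, one) (hom-ε (IsGroupAut.hom σ-aut)))

    module _ (α : GraphAut G R L) where
      open GraphAut α

      commutes⇒conjugate∈RG : ∀ {g k} → (∀ w → to (ρ G g w) ≡ ρ G k (to w)) →
        InRG G (λ v → to (ρ G g (from v)))
      commutes⇒conjugate∈RG {k = k} commutes =
        k , λ v → trans (commutes (from v)) (cong (ρ G k) (invʳ v))

      conjugate∈RG⇒commutes : ∀ {g} → ((k , _) : InRG G (λ v → to (ρ G g (from v)))) →
        ∀ w → to (ρ G g w) ≡ ρ G k (to w)
      conjugate∈RG⇒commutes {g} (k , conjugate≗ρk) w =
        trans (cong (to ∘ ρ G g) (sym (invˡ w))) (conjugate≗ρk (to w))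

      module _ {h : Carrier → Carrier} (h-hom : IsHom h) (to≗φh : ∀ v → to v ≡ φ G h v) where

        φ-shaped-isGroupAut : IsGroupAut G h
        φ-shaped-isGroupAut = record
          { hom = h-hom
          ; inverse = λ x → proj₁ (from (x , one))
          ; invˡ = λ x → cong proj₁ (trans (cong from (sym (to≗φh (x , one)))) (invˡ (x , one)))
          ; invʳ = λ x → cong proj₁ (trans (sym (to≗φh (from (x , one)))) (invʳ (x , one)))
          }

        φ-shaped-Conn⇔ : ∀ i z → Conn i z ⇔ Conn i (h z)
        φ-shaped-Conn⇔ i z = begin
          Conn i z                          ≡⟨ cong (Conn i) (sym (x//ε≈x z)) ⟩
          Conn i (z ∙ ε ⁻¹)                 ≡⟨ sym (Edge-within i ε z) ⟩
          Edge (ε , i) (z , i)              ≈⟨ ⇔.sym (Adj⇔Edge (ε , i) (z , i)) ⟩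
          Adj G R L (ε , i) (z , i)         ≈⟨ adj (ε , i) (z , i) ⟩
          Adj G R L (to (ε , i)) (to (z , i)) ≡⟨ cong₂ (Adj G R L) (to≗φh (ε , i)) (to≗φh (z , i)) ⟩
          Adj G R L (h ε , i) (h z , i)     ≈⟨ Adj⇔Edge (h ε , i) (h z , i) ⟩
          Edge (h ε , i) (h z , i)          ≡⟨ Edge-within i (h ε) (h z) ⟩
          Conn i (h z ∙ h ε ⁻¹)             ≡⟨ cong (λ e → Conn i (h z ∙ e ⁻¹)) (hom-ε h-hom) ⟩
          Conn i (h z ∙ ε ⁻¹)               ≡⟨ cong (Conn i) (x//ε≈x (h z)) ⟩
          Conn i (h z)                      ∎
          where open SetoidReasoning (⇔.⇔-setoid 0ℓ)

        φ-shaped-∈X : InX G R L to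
        φ-shaped-∈X = h , φ-shaped-isGroupAut , image≐ one , image≐ two , to≗φh
          where
          image≐ : ∀ i → _≐_ G (image G h (Conn i)) (Conn i)
          image≐ i =
            ∈⇔⇒image≐ (Conn i) (Conn i) (aut-surjective φ-shaped-isGroupAut) (φ-shaped-Conn⇔ i)

    normal⇒stabiliser⊆X : IsNormal G R L →
      ∀ (α : GraphAut G R L) → GraphAut.to α (v₁₁ G) ≡ v₁₁ G → InX G R L (GraphAut.to α)
    normal⇒stabiliser⊆X normal α fixes = φ-shaped-∈X α h-hom to≗φh
      where
      open GraphAut α

      h : Carrier → Carrier
      h g = proj₁ (normal α g)

      to-ρ : ∀ g w → to (ρ G g w) ≡ ρ G (h g) (to w)
      to-ρ g = conjugate∈RG⇒commutes α (normal α g)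

      to-translate : ∀ x i → to (x , i) ≡ ρ G (h x) (to (ε , i))
      to-translate x i = trans (cong (λ y → to (y , i)) (sym (identityˡ x))) (to-ρ x (ε , i))

      -- α commutes with right translations, so it sends all of layer i into the layer of
      -- α (ε , i); if both layers went to layer one, (ε , two) would not be in the image.
      to-ε-two : to (ε , two) ≡ (ε , two)
      to-ε-two with to (ε , two) in eq
      ... | c , two = cong (_, two) (sym ε≡c)
        where
        ε≡c : ε ≡ c
        ε≡c = Equivalence.to (Adj⇔Edge (ε , one) (c , two))
          (subst₂ (Adj G R L) fixes eq (Equivalence.to (adj (ε , one) (ε , two)) edge₁₂))
      ... | c , one = contradiction two≡one λ ()
        where
        to-ε-layer : ∀ i → proj₂ (to (ε , i)) ≡ one
        to-ε-layer one = cong proj₂ fixes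
        to-ε-layer two = cong proj₂ eq
        two≡one : two ≡ one
        two≡one = trans (cong proj₂ (sym (invʳ (ε , two))))
          (trans (cong proj₂ (to-translate _ _)) (to-ε-layer _))

      to-ε : ∀ i → to (ε , i) ≡ (ε , i)
      to-ε one = fixes
      to-ε two = to-ε-two

      to≗φh : ∀ v → to v ≡ φ G h v
      to≗φh (x , i) =
        trans (to-translate x i) (trans (cong (ρ G (h x)) (to-ε i)) (cong (_, i) (identityˡ (h x))))

      h-hom : IsHom h
      h-hom x y = cong proj₁ (begin
        (h (x ∙ y) , one)         ≡⟨ sym (to≗φh (x ∙ y , one)) ⟩
        to (ρ G y (x , one))      ≡⟨ to-ρ y (x , one) ⟩
        ρ G (h y) (to (x , one))  ≡⟨ cong (ρ G (h y)) (to≗φh (x , one)) ⟩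
        (h x ∙ h y , one)         ∎)
        where open ≡-Reasoning

    module _ (stabiliser≡X : StabEqX G R L) where

      stabilised⇒φ-factor : (α γ : GraphAut G R L) → GraphAut.to γ (GraphAut.to α (v₁₁ G)) ≡ v₁₁ G →
        ∃ λ σ → IsHom σ × ∀ v → GraphAut.to α v ≡ GraphAut.from γ (φ G σ v)
      stabilised⇒φ-factor α γ fixes with proj₁ stabiliser≡X (γ ∘ᵃ α) fixes
      ... | σ , σ-aut , _ , _ , γα≗φσ =
        σ , IsGroupAut.hom σ-aut , λ v → trans (sym (invˡ (GraphAut.to α v))) (cong from (γα≗φσ v))
        where open GraphAut γ using (from; invˡ)

      automorphism-isAffine : (∃ λ f → InY G R L f) →
        (α : GraphAut G R L) → IsAffine (GraphAut.to α)
      automorphism-isAffine (_ , τ , τ-aut , τR≐L , τL≐R , _) α with GraphAut.to α (v₁₁ G) in eq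
      ... | c , one with stabilised⇒φ-factor α (ρ-automorphism (c ⁻¹))
                           (trans (cong (ρ G (c ⁻¹)) eq) (cong (_, one) (inverseʳ c)))
      ...   | σ , σ-hom , α≗ = σ , σ-hom , c ⁻¹ ⁻¹ , id , λ x i → α≗ (x , i)
      automorphism-isAffine (_ , τ , τ-aut , τR≐L , τL≐R , _) α | c , two
        with stabilised⇒φ-factor α (ψ-automorphism τ-aut τR≐L τL≐R ∘ᵃ ρ-automorphism (c ⁻¹))
               (trans (cong (ψ G τ ∘ ρ G (c ⁻¹)) eq)
                      (cong (_, one) (trans (cong τ (inverseʳ c)) (hom-ε (IsGroupAut.hom τ-aut)))))
      ... | σ , σ-hom , α≗ =
        τ⁻¹ ∘ σ , ∘-isHom (aut-inverse-isHom τ-aut) σ-hom , c ⁻¹ ⁻¹ , swap G , α≗′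
        where
        τ⁻¹ : Carrier → Carrier
        τ⁻¹ = IsGroupAut.inverse τ-aut
        α≗′ : ∀ x i → GraphAut.to α (x , i) ≡ (τ⁻¹ (σ x) ∙ c ⁻¹ ⁻¹ , swap G i)
        α≗′ x one = α≗ (x , one)
        α≗′ x two = α≗ (x , two)

      stabiliser≡X⇒normal : (∃ λ f → InY G R L f) → IsNormal G R L
      stabiliser≡X⇒normal Y α g =
        commutes⇒conjugate∈RG α (proj₂ (affine-commutes-ρ (automorphism-isAffine Y α) g))

lemma2p1 : (G : FiniteAbelianGroup) (R L : Subset G) →
    let open FiniteAbelianGroup G in
    _≐_ G (inv-set G R) R → _≐_ G (inv-set G L) L →
    ¬ (R ε ⊎ L ε) →
    Connected G R L →
    (∃ λ f → InY G R L f) →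
    (IsNormal G R L → StabEqX G R L) × (StabEqX G R L → IsNormal G R L)
lemma2p1 G R L _ _ _ _ Y =
  (λ normal → normal⇒stabiliser⊆X G R L normal , X⊆stabiliser G R L)
  , (λ stabiliser≡X → stabiliser≡X⇒normal G R L stabiliser≡X Y)
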